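{- Let $n \in \mathbb{N}$, $n\ge 1$, and let $\sigma$ be a permutation of $[n]=\{1,\dots,n\}$. If $\sigma$ is a prefix normal word chain generator, then $\sigma(n) = 1$.
   Context: Words are over the binary alphabet $\{0,1\}$. For a word $w$, $|w|$ is its length, $|w|_1$ the number of occurrences of $1$ in $w$, $w[k]$ its $k$-th letter, and $\mathrm{pref}_k(w)$ its prefix of length $k$. A factor of $w$ is a contiguous subword $w[a..b]$. A word $w$ is prefix normal if for every factor $v$ of $w$ we have $|v|_1 \le |\mathrm{pref}_{|v|}(w)|_1$. A permutation $\sigma$ of $[n]$ is written in one-line notation $\sigma=\sigma[1]\sigma[2]\cdots\sigma[n]$ with $\sigma[i]=\sigma(i)$; any such permutation is called a word chain generator. Its word chain $c_\sigma=(c_\sigma[1],\dots,c_\sigma[n+1])$ is the sequence of words of length $n$ defined by $c_\sigma[1]=1^n$ and, for $i\in[n]$, $c_\sigma[i+1]$ is obtained from $c_\sigma[i]$ by changing the letter at position $\sigma(i)$ from $1$ to $0$ (so $c_\sigma[n+1]=0^n$). The generator $\sigma$ is a prefix normal word chain generator if every word $c_\sigma[i]$, $i\in[n+1]$, is prefix normal. -}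

module Defs where

open import Data.Nat using (ℕ; zero; suc; _+_; _≤_; _<?_)
open import Relation.Nullary using (yes; no)
open import Data.Bool using (Bool; true; false)
open import Data.Fin using (Fin; toℕ; fromℕ<) renaming (suc to fsuc; zero to fzero)
open import Data.Vec using (Vec; replicate; updateAt; toList)
open import Data.List using (List; []; _∷_; take; drop)
open import Data.Fin.Permutation using (Permutation′; _⟨$⟩ʳ_)
open import Function using (const)

-- Binary words of length n over {0,1}: letter 1 is 'true', letter 0 is 'false'.
-- Positions are 0-based: paper position k corresponds to Fin index k-1.
Word : ℕ → Set
Word n = Vec Bool n

ones : List Bool → ℕ
ones [] = 0
ones (true ∷ u) = suc (ones u)
ones (false ∷ u) = ones u

-- the factor w[a+1 .. a+len] (paper indexing) of w
factor : ∀ {n} → Word n → ℕ → ℕ → List Bool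
factor w a len = take len (drop a (toList w))

pref : ∀ {n} → ℕ → Word n → List Bool
pref k w = take k (toList w)

PrefixNormal : ∀ {n} → Word n → Set
PrefixNormal {n} w = ∀ (a len : ℕ) → a + len ≤ n →
  ones (factor w a len) ≤ ones (pref len w)

-- Word chain c_σ, 0-based: chain σ i (i : Fin (n+1)) is the paper's c_σ[i+1].
-- c_σ[1] = 1^n; c_σ[i+1] is c_σ[i] with the letter at position σ(i) set to 0.
-- chainAux σ k = the word after the first k steps (k ≤ n); for k > n the
-- steps σ(k) do not exist and are skipped (never used by 'chain').
chainAux : ∀ {n} → Permutation′ n → ℕ → Word n
chainAux {n} σ zero = replicate n true
chainAux {n} σ (suc k) with k <? n
... | yes k<n = updateAt (chainAux σ k) (σ ⟨$⟩ʳ fromℕ< k<n) (const false)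
... | no _ = chainAux σ k

chain : ∀ {n} → Permutation′ n → Fin (suc n) → Word n
chain σ i = chainAux σ (toℕ i)

PNGenerator : ∀ {n} → Permutation′ n → Set
PNGenerator {n} σ = ∀ (i : Fin (suc n)) → PrefixNormal (chain σ i)

{-# OPTIONS --safe #-}
-- The word c_σ[n] has a single letter 1, at position σ(n). Being prefix normal,
-- its length-1 factor at σ(n) has no more ones than its length-1 prefix, so its
-- first letter is that 1, i.e. σ(n) = 1.
module Submission where

open import Defs
open import Data.Nat using (ℕ; suc; zero; _+_; _<?_; _<_; _≤_; s≤s)
open import Data.Nat.Properties using (+-comm; ≤-reflexive; ≤-trans; <⇒≤; <⇒≢; <-≤-trans; ≮⇒≥; m<1+n⇒m<n∨m≡n; n≤1+n)
open import Data.Fin using (Fin; fromℕ; zero; suc; toℕ; fromℕ<; _≟_)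
open import Data.Fin.Properties using (toℕ-injective; toℕ<n; toℕ-fromℕ; toℕ-fromℕ<; ≤fromℕ; ≤∧≢⇒<)
open import Data.Fin.Permutation using (Permutation′; _⟨$⟩ʳ_; _⟨$⟩ˡ_; inverseʳ)
open import Data.Vec using (_∷_; lookup)
open import Data.Vec.Properties using (lookup∘updateAt; lookup∘updateAt′; lookup-replicate)
open import Data.List using () renaming ([] to []ˡ; _∷_ to _∷ˡ_)
open import Data.Bool using (true; false)
open import Data.Sum using (inj₁; inj₂)
open import Function using (Injection)
open import Function.Properties.Inverse using (↔⇒↣)
open import Relation.Nullary using (yes; no; contradiction)
open import Relation.Binary.PropositionalEquality using (_≡_; _≢_; ≢-sym; refl; sym; trans; cong; subst)

module _ {n : ℕ} (σ : Permutation′ n) where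

  private
    σ-injective : ∀ {i j} → σ ⟨$⟩ʳ i ≡ σ ⟨$⟩ʳ j → i ≡ j
    σ-injective = Injection.injective (↔⇒↣ σ)

    not-cleared-at-step : ∀ {k} (j : Fin n) (k<n : k < n) → toℕ j ≢ k →
                          σ ⟨$⟩ʳ j ≢ σ ⟨$⟩ʳ fromℕ< k<n
    not-cleared-at-step j k<n j≢k eq = j≢k (trans (cong toℕ (σ-injective eq)) (toℕ-fromℕ< k<n))

  lookup-chainAux-kept : ∀ k (j : Fin n) → k ≤ toℕ j →
                         lookup (chainAux σ k) (σ ⟨$⟩ʳ j) ≡ true
  lookup-chainAux-kept zero    j _   = lookup-replicate (σ ⟨$⟩ʳ j) true
  lookup-chainAux-kept (suc k) j k<j with k <? n
  ... | no _    = lookup-chainAux-kept k j (<⇒≤ k<j)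
  ... | yes k<n = trans (lookup∘updateAt′ _ _ (not-cleared-at-step j k<n (≢-sym (<⇒≢ k<j))) (chainAux σ k))
                        (lookup-chainAux-kept k j (<⇒≤ k<j))

  lookup-chainAux-cleared : ∀ k (j : Fin n) → toℕ j < k →
                            lookup (chainAux σ k) (σ ⟨$⟩ʳ j) ≡ false
  lookup-chainAux-cleared (suc k) j j<1+k with k <? n
  ... | no k≮n  = lookup-chainAux-cleared k j (<-≤-trans (toℕ<n j) (≮⇒≥ k≮n))
  ... | yes k<n with m<1+n⇒m<n∨m≡n j<1+k
  ...   | inj₁ j<k = trans (lookup∘updateAt′ _ _ (not-cleared-at-step j k<n (<⇒≢ j<k)) (chainAux σ k))
                           (lookup-chainAux-cleared k j j<k)
  ...   | inj₂ j≡k rewrite toℕ-injective (trans j≡k (sym (toℕ-fromℕ< k<n))) =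
    lookup∘updateAt (σ ⟨$⟩ʳ fromℕ< k<n) (chainAux σ k)

  PNGenerator⇒prefixNormal-chainAux : PNGenerator σ → ∀ {k} → k ≤ n → PrefixNormal (chainAux σ k)
  PNGenerator⇒prefixNormal-chainAux pn k≤n =
    subst (λ k → PrefixNormal (chainAux σ k)) (toℕ-fromℕ< (s≤s k≤n)) (pn (fromℕ< (s≤s k≤n)))

factor-length-one : ∀ {n} (w : Word n) (p : Fin n) → factor w (toℕ p) 1 ≡ lookup w p ∷ˡ []ˡ
factor-length-one (x ∷ w) zero    = refl
factor-length-one (x ∷ w) (suc p) = factor-length-one w p

prefixNormal-head : ∀ {n} (w : Word (suc n)) (p : Fin (suc n)) → PrefixNormal w →
                    lookup w p ≡ true → lookup w zero ≡ true
prefixNormal-head {n} w@(x ∷ _) p pn wp =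
  head-true (subst (λ v → ones v ≤ ones (x ∷ˡ []ˡ)) factor-p≡1 (pn (toℕ p) 1 p+1≤1+n))
  where
  p+1≤1+n : toℕ p + 1 ≤ suc n
  p+1≤1+n = ≤-trans (≤-reflexive (+-comm (toℕ p) 1)) (toℕ<n p)
  factor-p≡1 : factor w (toℕ p) 1 ≡ true ∷ˡ []ˡ
  factor-p≡1 = trans (factor-length-one w p) (cong (_∷ˡ []ˡ) wp)
  head-true : ∀ {b} → ones (true ∷ˡ []ˡ) ≤ ones (b ∷ˡ []ˡ) → b ≡ true
  head-true {true} _ = refl
  head-true {false} ()

mainTheorem1 : (m : ℕ) (σ : Permutation′ (suc m)) →
    PNGenerator σ → σ ⟨$⟩ʳ fromℕ m ≡ zero
mainTheorem1 m σ pn with σ ⟨$⟩ˡ zero ≟ fromℕ m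
... | yes σ⁻¹0≡last = trans (cong (σ ⟨$⟩ʳ_) (sym σ⁻¹0≡last)) (inverseʳ σ)
... | no  σ⁻¹0≢last = contradiction (trans (sym first-letter-cleared) first-letter-one) λ ()
  where
  w = chainAux σ m
  w-prefixNormal : PrefixNormal w
  w-prefixNormal = PNGenerator⇒prefixNormal-chainAux σ pn (n≤1+n m)
  last-letter-kept : lookup w (σ ⟨$⟩ʳ fromℕ m) ≡ true
  last-letter-kept = lookup-chainAux-kept σ m (fromℕ m) (≤-reflexive (sym (toℕ-fromℕ m)))
  σ⁻¹0<m : toℕ (σ ⟨$⟩ˡ zero) < m
  σ⁻¹0<m = subst (toℕ (σ ⟨$⟩ˡ zero) <_) (toℕ-fromℕ m) (≤∧≢⇒< (≤fromℕ _) σ⁻¹0≢last)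
  first-letter-cleared : lookup w zero ≡ false
  first-letter-cleared = subst (λ q → lookup w q ≡ false) (inverseʳ σ)
                               (lookup-chainAux-cleared σ m _ σ⁻¹0<m)
  first-letter-one : lookup w zero ≡ true
  first-letter-one = prefixNormal-head w _ w-prefixNormal last-letter-kept
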